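{- Assume $I_S\neq\emptyset$. Then $\mathrm{OPT}(G\cup\{a_{eff}\})\le\mathrm{OPT}(I_L^{red}\cup I_S)\le\mathrm{OPT}(I_L\cup I_S)=\mathrm{OPT}(I)\le 2P_0$.
   Context: UKP instance $I$: items with profits $p(a)\in(0,1]$, sizes $s(a)\in(0,1]$, capacity $c=1$; for a set $I'$ of items, $\mathrm{OPT}(I')=\max\{\sum p(a)x_a:\sum s(a)x_a\le c,\ x_a\in\mathbb{N}\}$. Let $\varepsilon=1/2^{\kappa-1}$, $\kappa\in\mathbb{N}$, $\varepsilon\le1/4$. Let $a_{me}$ maximize $p/s$ over $I$, $P_0=p(a_{me})\lfloor c/s(a_{me})\rfloor$, $T=\frac12\varepsilon P_0$, $K=\frac14\cdot\frac1{\kappa+1}\varepsilon T$, $I_L=\{a\in I:p(a)\ge T\}$, $I_S=I\setminus I_L$, $a_{eff}$ an item of $I_S$ maximizing $p/s$. For $k\in\{0,\dots,\kappa\}$ let $L_k=[2^kT,2^{k+1}T)$, and for $\gamma\in\{0,\dots,2^{\kappa+1}(\kappa+1)-1\}$, $L_{k,\gamma}=[2^kT+\gamma2^kK,\ 2^kT+(\gamma+1)2^kK)$; $L_{\kappa+1,0}=\{2P_0\}$. $a_{k,\gamma}$ is an item of minimum size among items of $I_L$ with profit in $L_{k,\gamma}$ (if any); $I_L^{red}$ is the set of all existing $a_{k,\gamma}$; $I_k=\{a\in I_L^{red}:p(a)\in L_k\}$. Gluing: for items $a_1,a_2$ with $s(a_1)+s(a_2)\le c$, $a_1\oplus a_2$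 is an item of profit $p(a_1)+p(a_2)$ and size $s(a_1)+s(a_2)$. $\tilde I_0=I_0$; for $k=0,\dots,\kappa-1$ and each $\gamma$, $\tilde a_{k+1,\gamma}$ is an item of minimum size among the items of $I_{k+1}\cup\{\tilde a\oplus\tilde a':\tilde a,\tilde a'\in\tilde I_k,\ s(\tilde a)+s(\tilde a')\le c\}$ with profit in $L_{k+1,\gamma}$ (if any), and $\tilde I_{k+1}$ is the set of existing $\tilde a_{k+1,\gamma}$. $G=\bigcup_{k=0}^{\kappa}\tilde I_k$.
   Formalization: The profits and sizes of the items are rational numbers in (0,1]. -}

module Defs where

open import Data.Nat as ℕ using (ℕ; zero; suc; _∸_)
open import Data.Integer using (ℤ; +_)
open import Data.Rational using (ℚ; 0ℚ; 1ℚ; ½; _+_; _*_; _≤_; _<_; _÷_; floor; _/_; ≢-nonZero)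
open import Data.Rational.Properties using (_≟_; _≤?_; _<?_)
open import Data.List using (List; []; _∷_; _++_; map; concatMap; filter; upTo; catMaybes; foldr)
open import Data.List.Membership.Propositional using (_∈_)
open import Data.List.Relation.Unary.All using (All)
open import Data.Maybe using (Maybe; just; nothing)
open import Data.Product using (Σ; _×_; _,_; uncurry)
open import Relation.Nullary using (¬_; yes; no)
open import Relation.Nullary.Decidable using (_×-dec_)
open import Relation.Binary.PropositionalEquality using (_≡_)

record Item : Set where
  constructor item
  field
    p : ℚ
    s : ℚ
open Item public

c : ℚ
c = 1ℚ

-- Efficiency p(a)/s(a) (sizes are positive for valid items; the value at s = 0 is a dummy).
eff : Item → ℚ
eff a with s a ≟ 0ℚ
... | yes _ = 0ℚ
... | no s≢0 = (p a ÷ s a) {{≢-nonZero s≢0}}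

⌊c/s⌋ : Item → ℚ
⌊c/s⌋ a with s a ≟ 0ℚ
... | yes _ = 0ℚ
... | no s≢0 = floor ((c ÷ s a) {{≢-nonZero s≢0}}) / 1

pow2 : ℕ → ℚ
pow2 zero = 1ℚ
pow2 (suc k) = (+ 2 / 1) * pow2 k

half^ : ℕ → ℚ
half^ zero = 1ℚ
half^ (suc k) = ½ * half^ k

ε : ℕ → ℚ
ε κ = half^ (κ ∸ 1)

ℕtoℚ : ℕ → ℚ
ℕtoℚ n = + n / 1

ValidItem : Item → Set
ValidItem a = (0ℚ < p a × p a ≤ 1ℚ) × (0ℚ < s a × s a ≤ 1ℚ)

ValidInstance : List Item → Set
ValidInstance I = All ValidItem I

sumℚ : List ℚ → ℚ
sumℚ = foldr _+_ 0ℚ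

profit : List Item → ℚ
profit xs = sumℚ (map p xs)

size : List Item → ℚ
size xs = sumℚ (map s xs)

-- A packing of items from I' : a multiset (list) of copies of items of I'
-- with total size ≤ c.  (Equivalent to x_a ∈ ℕ multiplicities.)
Packing : List Item → List Item → Set
Packing I' xs = All (_∈ I') xs × size xs ≤ c

IsOPT : List Item → ℚ → Set
IsOPT I' v =
  Σ (List Item) (λ xs → Packing I' xs × profit xs ≡ v)
  × (∀ xs → Packing I' xs → profit xs ≤ v)

_⊕_ : Item → Item → Item
a ⊕ b = item (p a + p b) (s a + s b)

glue : List Item → List Item
glue xs = filter (λ g → s g ≤? c) (concatMap (λ a → map (a ⊕_) xs) xs)

IsMinChoice : List Item → (ℚ → Set) → Maybe Item → Set
IsMinChoice xs P nothing = ∀ b → b ∈ xs → ¬ P (p b)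
IsMinChoice xs P (just a) =
  a ∈ xs × P (p a) × (∀ b → b ∈ xs → P (p b) → s a ≤ s b)

module Construction (κ : ℕ) (I : List Item) (ame : Item) where

  P0 : ℚ
  P0 = p ame * ⌊c/s⌋ ame

  T : ℚ
  T = ½ * (ε κ * P0)

  K : ℚ
  K = (+ 1 / 4) * ((+ 1 / suc κ) * (ε κ * T))

  IL : List Item
  IL = filter (λ a → T ≤? p a) I

  IS : List Item
  IS = filter (λ a → p a <? T) I

  N : ℕ
  N = (2 ℕ.^ suc κ) ℕ.* suc κ

  InLk : ℕ → ℚ → Set
  InLk k q = pow2 k * T ≤ q × q < pow2 (suc k) * T

  InL : ℕ → ℕ → ℚ → Set
  InL k γ q = pow2 k * T + ℕtoℚ γ * (pow2 k * K) ≤ q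
            × q < pow2 k * T + ℕtoℚ (suc γ) * (pow2 k * K)

  InLtop : ℚ → Set
  InLtop q = q ≡ (+ 2 / 1) * P0

  indices : List (ℕ × ℕ)
  indices = concatMap (λ k → map (k ,_) (upTo N)) (upTo (suc κ))

  SpecA : (ℕ → ℕ → Maybe Item) → Set
  SpecA A = (∀ k γ → k ℕ.≤ κ → γ ℕ.< N → IsMinChoice IL (InL k γ) (A k γ))
          × IsMinChoice IL InLtop (A (suc κ) 0)

  ILred : (ℕ → ℕ → Maybe Item) → List Item
  ILred A = catMaybes (map (uncurry A) indices ++ (A (suc κ) 0 ∷ []))

  Ik : (ℕ → ℕ → Maybe Item) → ℕ → List Item
  Ik A k = filter (λ a → (pow2 k * T ≤? p a) ×-dec (p a <? pow2 (suc k) * T)) (ILred A)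

  Ĩ : (ℕ → ℕ → Maybe Item) → (ℕ → ℕ → Maybe Item) → ℕ → List Item
  Ĩ A Ã zero = Ik A 0
  Ĩ A Ã (suc k) = catMaybes (map (Ã (suc k)) (upTo N))

  SpecÃ : (ℕ → ℕ → Maybe Item) → (ℕ → ℕ → Maybe Item) → Set
  SpecÃ A Ã = ∀ k γ → k ℕ.< κ → γ ℕ.< N →
    IsMinChoice (Ik A (suc k) ++ glue (Ĩ A Ã k)) (InL (suc k) γ) (Ã (suc k) γ)

  G : (ℕ → ℕ → Maybe Item) → (ℕ → ℕ → Maybe Item) → List Item
  G A Ã = concatMap (Ĩ A Ã) (upTo (suc κ))

module Submission where

-- Every item of G is by construction a gluing of items of I_L^red, and a_eff ∈ I_S. Ungluing
-- a packing of G ∪ {a_eff} therefore gives a packing of I_L^red ∪ I_S of the same profit and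
-- size, which is the first inequality; the second is monotonicity, as I_L^red ⊆ I_L, and
-- I_L ∪ I_S has the same items as I. For the last one, maximality of p/s at a_me gives
-- p(b) s(a_me) ≤ p(a_me) s(b) for every item b, so a packing has profit at most
-- p(a_me)/s(a_me) ≤ 2 p(a_me) ⌊1/s(a_me)⌋ = 2P₀, using s(a_me) ≤ 1. The optima exist because
-- item sizes are bounded away from 0, so packings have bounded length.

open import Defs
import Algebra.Definitions.RawMonoid as RawMonoid
open import Data.Nat as ℕ using (ℕ; zero; suc; NonZero)
import Data.Nat.Properties as ℕP
import Data.Nat.DivMod as ℕD
import Data.Nat.Solver as ℕSolver
open import Data.Integer as ℤ using (+_; +[1+_]; -[1+_])
import Data.Integer.Properties as ℤP
import Data.Integer.Solver as ℤSolver
open import Data.Rational as ℚ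
  using (ℚ; mkℚ; 0ℚ; 1ℚ; _≤_; _<_; _+_; _*_; _/_; _÷_; 1/_; floor; toℚᵘ)
import Data.Rational.Properties as ℚP
import Data.Rational.Solver as ℚSolver
open import Data.Rational.Unnormalised as ℚᵘ using (mkℚᵘ; _≃_)
import Data.Rational.Unnormalised.Properties as ℚᵘP
open import Relation.Binary.PropositionalEquality
  using (_≡_; _≢_; refl; sym; trans; cong; cong₂; subst; subst₂; module ≡-Reasoning)
open import Relation.Binary.Bundles using (DecTotalOrder)
open import Relation.Nullary using (yes; no; contradiction)
open import Function using (id; _∘_)
open import Data.Product using (Σ; ∃-syntax; ∃₂; _×_; _,_; proj₁; proj₂; uncurry)
open import Data.Sum using (inj₁; inj₂)
open import Data.Maybe using (Maybe; just; nothing)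
open import Data.List
  using (List; []; _∷_; _++_; [_]; length; map; filter; catMaybes; upTo; cartesianProductWith)
open import Data.List.Membership.Propositional using (_∈_; find)
open import Data.List.Membership.Propositional.Properties
  using (∈-cartesianProductWith⁺; ∈-cartesianProductWith⁻; ∈-filter⁺; ∈-filter⁻;
         ∈-map⁻; ∈-concatMap⁻; ∈-++⁺ˡ; ∈-++⁺ʳ; ∈-++⁻; ∈-upTo⁻)
open import Data.List.Relation.Binary.Subset.Propositional using (_⊆_)
open import Data.List.Relation.Binary.Subset.Propositional.Properties
  using (filter-⊆; xs⊆xs++ys; ++⁺ˡ)
open import Data.List.Relation.Unary.All as All using (All; []; _∷_)
import Data.List.Relation.Unary.All.Properties as AllP
open import Data.List.Relation.Unary.Any using (here; there)
open import Data.List.Extrema (DecTotalOrder.totalOrder ℚP.≤-decTotalOrder)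
  using (min; min≤xs; argmin-all; argmax; argmax-all; f[xs]≤f[argmax])

open RawMonoid ℚ.+-0-rawMonoid using () renaming (_×_ to _·_)
open RawMonoid ℚᵘ.+-0-rawMonoid using () renaming (_×_ to _·ᵘ_)

0<1 : 0ℚ < 1ℚ
0<1 = ℚ.*<* (ℤ.+<+ (ℕ.s≤s ℕ.z≤n))

toℚᵘ-· : ∀ n q → toℚᵘ (n · q) ≃ n ·ᵘ toℚᵘ q
toℚᵘ-· zero    q = ℚᵘP.≃-refl
toℚᵘ-· (suc n) q =
  ℚᵘP.≃-trans (ℚP.toℚᵘ-homo-+ q (n · q)) (ℚᵘP.+-congʳ (toℚᵘ q) (toℚᵘ-· n q))

·ᵘ-mkℚᵘ : ∀ n a d → n ·ᵘ mkℚᵘ (+ a) d ≃ mkℚᵘ (+ (n ℕ.* a)) d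
·ᵘ-mkℚᵘ zero    a d = ℚᵘ.*≡* refl
·ᵘ-mkℚᵘ (suc n) a d =
  ℚᵘP.≃-trans (ℚᵘP.+-congʳ (mkℚᵘ (+ a) d) (·ᵘ-mkℚᵘ n a d)) (ℚᵘ.*≡* cross)
  where
  open ℤSolver.+-*-Solver
  cross : (+ a ℤ.* + suc d ℤ.+ + (n ℕ.* a) ℤ.* + suc d) ℤ.* + suc d
        ≡ + (suc n ℕ.* a) ℤ.* + (suc d ℕ.* suc d)
  cross = trans
    (solve 3 (λ A B D → (A :* D :+ B :* D) :* D := (A :+ B) :* (D :* D)) refl
       (+ a) (+ (n ℕ.* a)) (+ suc d))
    (sym (cong₂ ℤ._*_ (ℤP.pos-+ a (n ℕ.* a)) (ℤP.pos-* (suc d) (suc d))))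

archimedean : ∀ δ → 0ℚ < δ → ∃[ m ] 1ℚ < m · δ
archimedean δ@(mkℚ +[1+ a ] d _) _ =
  m , ℚP.toℚᵘ-cancel-< (ℚᵘP.<-respʳ-≃ (ℚᵘP.≃-sym mδ≃) 1<mδ)
  where
  m = suc (suc d)
  mδ≃ : toℚᵘ (m · δ) ≃ mkℚᵘ (+ (m ℕ.* suc a)) d
  mδ≃ = ℚᵘP.≃-trans (toℚᵘ-· m δ) (·ᵘ-mkℚᵘ m (suc a) d)
  1<mδ : ℚᵘ.1ℚᵘ ℚᵘ.< mkℚᵘ (+ (m ℕ.* suc a)) d
  1<mδ = ℚᵘ.*<* (subst₂ ℤ._<_ (sym (ℤP.*-identityˡ _)) (sym (ℤP.*-identityʳ _))
           (ℤ.+<+ (ℕP.<-≤-trans (ℕP.n<1+n (suc d)) (ℕP.m≤m*n m (suc a)))))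
archimedean (mkℚ (+ zero) _ _) (ℚ.*<* (ℤ.+<+ ()))
archimedean (mkℚ -[1+ _ ] _ _) (ℚ.*<* ())

·-nonNeg : ∀ {δ} → 0ℚ ≤ δ → ∀ n → 0ℚ ≤ n · δ
·-nonNeg 0≤δ zero    = ℚP.≤-refl
·-nonNeg 0≤δ (suc n) = ℚP.+-mono-≤ 0≤δ (·-nonNeg 0≤δ n)

·-monoˡ-≤ : ∀ {δ} → 0ℚ ≤ δ → ∀ {m n} → m ℕ.≤ n → m · δ ≤ n · δ
·-monoˡ-≤     0≤δ {n = n} ℕ.z≤n = ·-nonNeg 0≤δ n
·-monoˡ-≤ {δ} 0≤δ (ℕ.s≤s m≤n)   = ℚP.+-monoʳ-≤ δ (·-monoˡ-≤ 0≤δ m≤n)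

·-cancelʳ-< : ∀ {δ} → 0ℚ ≤ δ → ∀ {m n} → m · δ < n · δ → m ℕ.< n
·-cancelʳ-< 0≤δ mδ<nδ =
  ℕP.≰⇒> λ n≤m → ℚP.<-irrefl refl (ℚP.<-≤-trans mδ<nδ (·-monoˡ-≤ 0≤δ n≤m))

n≤2*[n/m]*m : ∀ m n .{{_ : NonZero m}} → m ℕ.≤ n → n ℕ.≤ 2 ℕ.* (n ℕD./ m) ℕ.* m
n≤2*[n/m]*m m n m≤n = begin
  n                        ≡⟨ ℕD.m≡m%n+[m/n]*n n m ⟩
  n ℕD.% m ℕ.+ q ℕ.* m     ≤⟨ ℕP.+-monoˡ-≤ (q ℕ.* m) n%m≤q*m ⟩
  q ℕ.* m ℕ.+ q ℕ.* m      ≡⟨ solve 2 (λ q m → q :* m :+ q :* m := con 2 :* q :* m) refl q m ⟩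
  2 ℕ.* q ℕ.* m            ∎
  where
  open ℕP.≤-Reasoning
  open ℕSolver.+-*-Solver
  q = n ℕD./ m
  n%m≤q*m : n ℕD.% m ℕ.≤ q ℕ.* m
  n%m≤q*m = ℕP.≤-trans (ℕP.<⇒≤ (ℕD.m%n<n n m))
              (ℕP.m≤n*m m q {{ℕ.>-nonZero (ℕD.m≥n⇒m/n>0 m≤n)}})

-- For q = (1+a)/(1+d) ≤ 1 we have ⌊1/q⌋ = (1+d) div (1+a), and the claim becomes 1+d ≤ 2⌊1/q⌋(1+a).
1≤2*⌊1/q⌋*q : ∀ q .{{_ : ℚ.NonZero q}} → 0ℚ < q → q ≤ 1ℚ →
              1ℚ ≤ ((+ 2 / 1) * (floor (c ÷ q) / 1)) * q
1≤2*⌊1/q⌋*q q@(mkℚ +[1+ a ] d _) _ (ℚ.*≤* (ℤ.+≤+ q≤1)) =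
  subst (λ z → 1ℚ ≤ ((+ 2 / 1) * (z / 1)) * q) (sym ⌊1/q⌋≡k)
    (ℚP.toℚᵘ-cancel-≤ (ℚᵘP.≤-respʳ-≃ (ℚᵘP.≃-sym toℚᵘ[2kq]≃) (ℚᵘ.*≤* integral)))
  where
  k = suc d ℕD./ suc a
  ⌊1/q⌋≡k : floor (c ÷ q) ≡ + k
  ⌊1/q⌋≡k = trans (cong floor (ℚP.*-identityˡ (1/ q))) (ℤP.*-identityˡ (+ k))
  2kq = mkℚᵘ (+ 2) 0 ℚᵘ.* mkℚᵘ (+ k) 0 ℚᵘ.* mkℚᵘ (+ suc a) d
  toℚᵘ[2kq]≃ : toℚᵘ ((+ 2 / 1) * (+ k / 1) * q) ≃ 2kq
  toℚᵘ[2kq]≃ = ℚᵘP.≃-trans (ℚP.toℚᵘ-homo-* ((+ 2 / 1) * (+ k / 1)) q)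
    (ℚᵘP.*-congʳ (ℚᵘP.≃-trans (ℚP.toℚᵘ-homo-* (+ 2 / 1) (+ k / 1))
      (ℚᵘP.*-congˡ {mkℚᵘ (+ 2) 0} (ℚP.toℚᵘ-fromℚᵘ (mkℚᵘ (+ k) 0)))))
  a≤d : a ℕ.≤ d
  a≤d = ℕP.≤-pred (subst₂ ℕ._≤_ (ℕP.*-identityʳ (suc a)) (ℕP.+-identityʳ (suc d)) q≤1)
  natural : 1 ℕ.* (1 ℕ.* suc d) ℕ.≤ 2 ℕ.* k ℕ.* suc a ℕ.* 1
  natural =
    subst₂ ℕ._≤_ (sym (trans (ℕP.*-identityˡ _) (ℕP.*-identityˡ _))) (sym (ℕP.*-identityʳ _))
      (n≤2*[n/m]*m (suc a) (suc d) (ℕ.s≤s a≤d))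
  integral : + 1 ℤ.* + (1 ℕ.* suc d) ℤ.≤ ((+ 2 ℤ.* + k) ℤ.* + suc a) ℤ.* + 1
  integral = subst₂ ℤ._≤_ (ℤP.pos-* 1 (1 ℕ.* suc d))
    (trans (ℤP.pos-* (2 ℕ.* k ℕ.* suc a) 1) (cong (ℤ._* + 1)
      (trans (ℤP.pos-* (2 ℕ.* k) (suc a)) (cong (ℤ._* + suc a) (ℤP.pos-* 2 k)))))
    (ℤ.+≤+ natural)
1≤2*⌊1/q⌋*q (mkℚ (+ zero) _ _) (ℚ.*<* (ℤ.+<+ ())) _
1≤2*⌊1/q⌋*q (mkℚ -[1+ _ ] _ _) (ℚ.*<* ()) _

÷-≤⇒*-≤ : ∀ x y u v .{{_ : ℚ.NonZero u}} .{{_ : ℚ.NonZero v}} → 0ℚ < u → 0ℚ < v →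
          x ÷ u ≤ y ÷ v → x * v ≤ y * u
÷-≤⇒*-≤ x y u v 0<u 0<v x/u≤y/v = begin
  x * v              ≡⟨ sym (cancel x u v) ⟩
  (x ÷ u) * (u * v)  ≤⟨ ℚP.*-monoʳ-≤-nonNeg (u * v) {{uv≥0}} x/u≤y/v ⟩
  (y ÷ v) * (u * v)  ≡⟨ cong ((y ÷ v) *_) (ℚP.*-comm u v) ⟩
  (y ÷ v) * (v * u)  ≡⟨ cancel y v u ⟩
  y * u              ∎
  where
  open ℚP.≤-Reasoning
  uv≥0 = ℚP.nonNeg*nonNeg⇒nonNeg u {{ℚ.nonNegative (ℚP.<⇒≤ 0<u)}}
                                 v {{ℚ.nonNegative (ℚP.<⇒≤ 0<v)}}
  cancel : ∀ x u w .{{_ : ℚ.NonZero u}} → (x ÷ u) * (u * w) ≡ x * w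
  cancel x u w = begin-equality
    (x * 1/ u) * (u * w)  ≡⟨ solve 4 (λ X I U W → (X :* I) :* (U :* W) := X :* ((I :* U) :* W))
                                    refl x (1/ u) u w ⟩
    x * ((1/ u * u) * w)  ≡⟨ cong (λ i → x * (i * w)) (ℚP.*-inverseˡ u) ⟩
    x * (1ℚ * w)          ≡⟨ cong (x *_) (ℚP.*-identityˡ w) ⟩
    x * w                 ∎
    where open ℚSolver.+-*-Solver

1≤2*⌊c/s⌋*s : ∀ a → 0ℚ < s a → s a ≤ 1ℚ → 1ℚ ≤ ((+ 2 / 1) * ⌊c/s⌋ a) * s a
1≤2*⌊c/s⌋*s a 0<s s≤1 with s a ℚP.≟ 0ℚ
... | yes s≡0 = contradiction (sym s≡0) (ℚP.<⇒≢ 0<s)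
... | no  s≢0 = 1≤2*⌊1/q⌋*q (s a) {{ℚ.≢-nonZero s≢0}} 0<s s≤1

eff≤⇒p*s≤p*s : ∀ a b → 0ℚ < s a → 0ℚ < s b → eff b ≤ eff a → p b * s a ≤ p a * s b
eff≤⇒p*s≤p*s a b 0<sa 0<sb with s a ℚP.≟ 0ℚ | s b ℚP.≟ 0ℚ
... | yes sa≡0 | _        = contradiction (sym sa≡0) (ℚP.<⇒≢ 0<sa)
... | no  _    | yes sb≡0 = contradiction (sym sb≡0) (ℚP.<⇒≢ 0<sb)
... | no  sa≢0 | no  sb≢0 =
  ÷-≤⇒*-≤ (p b) (p a) (s b) (s a) {{ℚ.≢-nonZero sb≢0}} {{ℚ.≢-nonZero sa≢0}} 0<sb 0<sa

profit*s≤p*size : ∀ a xs → All (λ b → p b * s a ≤ p a * s b) xs → profit xs * s a ≤ p a * size xs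
profit*s≤p*size a [] [] =
  ℚP.≤-reflexive (trans (ℚP.*-zeroˡ (s a)) (sym (ℚP.*-zeroʳ (p a))))
profit*s≤p*size a (b ∷ xs) (b≤ ∷ xs≤) = begin
  (p b + profit xs) * s a      ≡⟨ ℚP.*-distribʳ-+ (s a) (p b) (profit xs) ⟩
  p b * s a + profit xs * s a  ≤⟨ ℚP.+-mono-≤ b≤ (profit*s≤p*size a xs xs≤) ⟩
  p a * s b + p a * size xs    ≡⟨ sym (ℚP.*-distribˡ-+ (p a) (s b) (size xs)) ⟩
  p a * (s b + size xs)        ∎
  where open ℚP.≤-Reasoning

profit≤2P₀ : ∀ a xs → 0ℚ ≤ p a → 0ℚ < s a → s a ≤ 1ℚ → size xs ≤ 1ℚ →
             All (λ b → p b * s a ≤ p a * s b) xs → profit xs ≤ (+ 2 / 1) * (p a * ⌊c/s⌋ a)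
profit≤2P₀ a xs 0≤pa 0<sa sa≤1 size≤1 xs≤ =
  ℚP.*-cancelʳ-≤-pos (s a) {{ℚ.positive 0<sa}} (begin
    profit xs * s a              ≤⟨ profit*s≤p*size a xs xs≤ ⟩
    p a * size xs                ≤⟨ ℚP.*-monoˡ-≤-nonNeg (p a) size≤1 ⟩
    p a * 1ℚ                     ≤⟨ ℚP.*-monoˡ-≤-nonNeg (p a) (1≤2*⌊c/s⌋*s a 0<sa sa≤1) ⟩
    p a * ((+ 2 / 1 * f) * s a)  ≡⟨ solve 4 (λ P T F S → P :* ((T :* F) :* S) := (T :* (P :* F)) :* S)
                                          refl (p a) (+ 2 / 1) f (s a) ⟩
    (+ 2 / 1) * (p a * f) * s a  ∎)
  where
  open ℚP.≤-Reasoning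
  open ℚSolver.+-*-Solver
  f = ⌊c/s⌋ a
  instance
    pa≥0 : ℚ.NonNegative (p a)
    pa≥0 = ℚ.nonNegative 0≤pa

PositiveSizes : List Item → Set
PositiveSizes = All (λ x → 0ℚ < s x)

size-lower-bound : ∀ {L} → PositiveSizes L → ∃[ δ ] 0ℚ < δ × All (λ x → δ ≤ s x) L
size-lower-bound {L} pos =
  min 1ℚ (map s L) ,
  argmin-all id {P = 0ℚ <_} 0<1 (AllP.map⁺ pos) ,
  AllP.map⁻ (min≤xs 1ℚ (map s L))

length·≤size : ∀ {δ} xs → All (λ x → δ ≤ s x) xs → length xs · δ ≤ size xs
length·≤size []       []         = ℚP.≤-refl
length·≤size (x ∷ xs) (δ≤ ∷ δ≤s) = ℚP.+-mono-≤ δ≤ (length·≤size xs δ≤s)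

packing-length-bound : ∀ {L} → PositiveSizes L → ∃[ m ] ∀ xs → Packing L xs → length xs ℕ.< m
packing-length-bound pos with size-lower-bound pos
... | δ , 0<δ , δ≤L with archimedean δ 0<δ
... | m , 1<mδ = m , λ xs (xs⊆L , size≤1) → ·-cancelʳ-< (ℚP.<⇒≤ 0<δ)
  (ℚP.≤-<-trans (ℚP.≤-trans (length·≤size xs (All.map (All.lookup δ≤L) xs⊆L)) size≤1) 1<mδ)

listsShorterThan : ∀ {A : Set} → ℕ → List A → List (List A)
listsShorterThan zero    xs = []
listsShorterThan (suc m) xs = [] ∷ cartesianProductWith _∷_ xs (listsShorterThan m xs)

∈-listsShorterThan⁺ : ∀ {A : Set} {xs ys : List A} {m} →
                      All (_∈ xs) ys → length ys ℕ.< m → ys ∈ listsShorterThan m xs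
∈-listsShorterThan⁺ {ys = []}    []         (ℕ.s≤s _)    = here refl
∈-listsShorterThan⁺ {ys = _ ∷ _} (y∈ ∷ ys⊆) (ℕ.s≤s ys<m) =
  there (∈-cartesianProductWith⁺ _∷_ y∈ (∈-listsShorterThan⁺ ys⊆ ys<m))

∈-listsShorterThan⁻ : ∀ {A : Set} {xs ys : List A} m →
                      ys ∈ listsShorterThan m xs → All (_∈ xs) ys
∈-listsShorterThan⁻ (suc m) (here refl) = []
∈-listsShorterThan⁻ {xs = xs} (suc m) (there ys∈)
  with _ , _ , y∈ , zs∈ , refl ← ∈-cartesianProductWith⁻ _∷_ xs (listsShorterThan m xs) ys∈
  = y∈ ∷ ∈-listsShorterThan⁻ m zs∈

-- Packings have bounded length, so an optimal one is found among finitely many lists.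
isOPT-exists : ∀ L → PositiveSizes L → Σ ℚ (IsOPT L)
isOPT-exists L pos = profit best , (best , best-packs , refl) , best-max
  where
  m = proj₁ (packing-length-bound pos)
  fits? = λ xs → size xs ℚP.≤? c
  candidates = filter fits? (listsShorterThan m L)
  best = argmax profit [] candidates
  best-packs : Packing L best
  best-packs = argmax-all profit ([] , ℚP.<⇒≤ 0<1) (All.tabulate λ xs∈ →
    let xs∈lists , fits = ∈-filter⁻ fits? {xs = listsShorterThan m L} xs∈
    in ∈-listsShorterThan⁻ m xs∈lists , fits)
  best-max : ∀ xs → Packing L xs → profit xs ≤ profit best
  best-max xs packs@(xs⊆L , fits) = All.lookup (f[xs]≤f[argmax] [] candidates)
    (∈-filter⁺ fits? (∈-listsShorterThan⁺ xs⊆L (proj₂ (packing-length-bound pos) xs packs)) fits)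

isOPT≤2P₀ : ∀ {L v} a → ValidItem a → PositiveSizes L → (∀ b → b ∈ L → eff b ≤ eff a) →
            IsOPT L v → v ≤ (+ 2 / 1) * (p a * ⌊c/s⌋ a)
isOPT≤2P₀ a ((0<pa , _) , (0<sa , sa≤1)) pos a-max ((xs , (xs⊆L , fits) , refl) , _) =
  profit≤2P₀ a xs (ℚP.<⇒≤ 0<pa) 0<sa sa≤1 fits
    (All.map (λ {b} b∈L → eff≤⇒p*s≤p*s a b 0<sa (All.lookup pos b∈L) (a-max b b∈L)) xs⊆L)

isOPT-resp-⊆⊇ : ∀ {L L′ v} → IsOPT L v → L ⊆ L′ → L′ ⊆ L → IsOPT L′ v
isOPT-resp-⊆⊇ ((xs , (xs⊆L , fits) , eq) , v-max) L⊆L′ L′⊆L =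
  (xs , (All.map L⊆L′ xs⊆L , fits) , eq) ,
  λ ys (ys⊆L′ , ys-fits) → v-max ys (All.map L′⊆L ys⊆L′ , ys-fits)

data Glued (L : List Item) : Item → Set where
  atom : ∀ {x} → x ∈ L → Glued L x
  _⊕ᵍ_ : ∀ {a b} → Glued L a → Glued L b → Glued L (a ⊕ b)

infix 4 _⊆⊕_
_⊆⊕_ : List Item → List Item → Set
L ⊆⊕ L′ = ∀ {x} → x ∈ L → Glued L′ x

⊆⇒⊆⊕ : ∀ {L L′} → L ⊆ L′ → L ⊆⊕ L′
⊆⇒⊆⊕ L⊆L′ x∈ = atom (L⊆L′ x∈)

Glued-mono : ∀ {L L′ x} → L ⊆ L′ → Glued L x → Glued L′ x
Glued-mono L⊆L′ (atom x∈L) = atom (L⊆L′ x∈L)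
Glued-mono L⊆L′ (g ⊕ᵍ h)   = Glued-mono L⊆L′ g ⊕ᵍ Glued-mono L⊆L′ h

Glued-positive : ∀ {L x} → PositiveSizes L → Glued L x → 0ℚ < s x
Glued-positive pos (atom x∈L) = All.lookup pos x∈L
Glued-positive pos (_⊕ᵍ_ {a} {b} g h) = subst (_< s a + s b) (ℚP.+-identityˡ 0ℚ)
  (ℚP.+-mono-< (Glued-positive pos g) (Glued-positive pos h))

⊆⊕-positive : ∀ {L L′} → L ⊆⊕ L′ → PositiveSizes L′ → PositiveSizes L
⊆⊕-positive L⊆⊕L′ pos = All.tabulate λ x∈ → Glued-positive pos (L⊆⊕L′ x∈)

flatten : ∀ {L x} → Glued L x → List Item
flatten (atom {x} _) = x ∷ []
flatten (g ⊕ᵍ h)     = flatten g ++ flatten h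

flattenAll : ∀ {L xs} → All (Glued L) xs → List Item
flattenAll []       = []
flattenAll (g ∷ gs) = flatten g ++ flattenAll gs

flatten-⊆ : ∀ {L x} (g : Glued L x) → All (_∈ L) (flatten g)
flatten-⊆ (atom x∈L) = x∈L ∷ []
flatten-⊆ (g ⊕ᵍ h)   = AllP.++⁺ (flatten-⊆ g) (flatten-⊆ h)

flattenAll-⊆ : ∀ {L xs} (gs : All (Glued L) xs) → All (_∈ L) (flattenAll gs)
flattenAll-⊆ []       = []
flattenAll-⊆ (g ∷ gs) = AllP.++⁺ (flatten-⊆ g) (flattenAll-⊆ gs)

Additive : (Item → ℚ) → Set
Additive f = ∀ a b → f (a ⊕ b) ≡ f a + f b

sumℚ-map-++ : ∀ (f : Item → ℚ) xs ys →
              sumℚ (map f (xs ++ ys)) ≡ sumℚ (map f xs) + sumℚ (map f ys)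
sumℚ-map-++ f []       ys = sym (ℚP.+-identityˡ _)
sumℚ-map-++ f (x ∷ xs) ys =
  trans (cong (λ t → f x + t) (sumℚ-map-++ f xs ys)) (sym (ℚP.+-assoc (f x) _ _))

sum-flatten : ∀ {f L x} → Additive f → (g : Glued L x) → sumℚ (map f (flatten g)) ≡ f x
sum-flatten {f} additive (atom {x} _)       = ℚP.+-identityʳ (f x)
sum-flatten {f} additive (_⊕ᵍ_ {a} {b} g h) = begin
  sumℚ (map f (flatten g ++ flatten h))                ≡⟨ sumℚ-map-++ f (flatten g) (flatten h) ⟩
  sumℚ (map f (flatten g)) + sumℚ (map f (flatten h))  ≡⟨ cong₂ _+_ (sum-flatten additive g)
                                                                    (sum-flatten additive h) ⟩
  f a + f b                                            ≡⟨ sym (additive a b) ⟩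
  f (a ⊕ b)                                            ∎
  where open ≡-Reasoning

sum-flattenAll : ∀ {f L xs} → Additive f → (gs : All (Glued L) xs) →
                 sumℚ (map f (flattenAll gs)) ≡ sumℚ (map f xs)
sum-flattenAll     additive []       = refl
sum-flattenAll {f} additive (g ∷ gs) =
  trans (sumℚ-map-++ f (flatten g) (flattenAll gs))
        (cong₂ _+_ (sum-flatten additive g) (sum-flattenAll additive gs))

-- Ungluing an optimal packing of L yields a packing of L′ with the same profit and size.
isOPT-mono-⊆⊕ : ∀ {L L′ v w} → IsOPT L v → IsOPT L′ w → L ⊆⊕ L′ → v ≤ w
isOPT-mono-⊆⊕ ((xs , (xs⊆L , fits) , refl) , _) (_ , w-max) L⊆⊕L′ =
  subst (_≤ _) (sum-flattenAll (λ _ _ → refl) gs)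
    (w-max (flattenAll gs)
      (flattenAll-⊆ gs , subst (_≤ c) (sym (sum-flattenAll (λ _ _ → refl) gs)) fits))
  where
  gs = All.map L⊆⊕L′ xs⊆L

∈-catMaybes⁻ : ∀ {A : Set} {x : A} ms → x ∈ catMaybes ms → just x ∈ ms
∈-catMaybes⁻ (just _ ∷ ms)  (here refl) = here refl
∈-catMaybes⁻ (just _ ∷ ms)  (there x∈)  = there (∈-catMaybes⁻ ms x∈)
∈-catMaybes⁻ (nothing ∷ ms) x∈          = there (∈-catMaybes⁻ ms x∈)

∈-glue⁻ : ∀ {xs x} → x ∈ glue xs → ∃₂ λ a b → a ∈ xs × b ∈ xs × x ≡ a ⊕ b
∈-glue⁻ {xs} x∈
  with a , a∈ , x∈a⊕xs ← find (∈-concatMap⁻ (λ a → map (a ⊕_) xs)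
                                (proj₁ (∈-filter⁻ (λ g → s g ℚP.≤? c) x∈)))
  with b , b∈ , refl ← ∈-map⁻ (a ⊕_) x∈a⊕xs
  = a , b , a∈ , b∈ , refl

∈-chosen : ∀ {xs P m x} → IsMinChoice xs P m → m ≡ just x → x ∈ xs
∈-chosen (x∈ , _) refl = x∈

module _ (κ : ℕ) (I : List Item) (ame : Item) where
  open Construction κ I ame

  I⊆IL++IS : I ⊆ IL ++ IS
  I⊆IL++IS {x} x∈ with T ℚP.≤? p x
  ... | yes T≤p = ∈-++⁺ˡ (∈-filter⁺ (λ a → T ℚP.≤? p a) x∈ T≤p)
  ... | no  T≰p = ∈-++⁺ʳ IL (∈-filter⁺ (λ a → p a ℚP.<? T) x∈ (ℚP.≰⇒> T≰p))

  IL++IS⊆I : IL ++ IS ⊆ I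
  IL++IS⊆I x∈ with ∈-++⁻ IL x∈
  ... | inj₁ x∈IL = filter-⊆ (λ a → T ℚP.≤? p a) I x∈IL
  ... | inj₂ x∈IS = filter-⊆ (λ a → p a ℚP.<? T) I x∈IS

  ILred⊆IL : ∀ {A} → SpecA A → ILred A ⊆ IL
  ILred⊆IL {A} (spec , spec-top) x∈
    with ∈-++⁻ (map (uncurry A) indices)
               (∈-catMaybes⁻ (map (uncurry A) indices ++ [ A (suc κ) 0 ]) x∈)
  ... | inj₂ (here x≡top) = ∈-chosen spec-top (sym x≡top)
  ... | inj₁ x∈grid
    with (k , γ) , kγ∈ , x≡Akγ ← ∈-map⁻ (uncurry A) x∈grid
    with k′ , k′∈ , kγ∈row ← find (∈-concatMap⁻ (λ k → map (k ,_) (upTo N)) kγ∈)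
    with γ′ , γ′∈ , refl ← ∈-map⁻ (k′ ,_) kγ∈row
    = ∈-chosen (spec k γ (ℕP.≤-pred (∈-upTo⁻ k′∈)) (∈-upTo⁻ γ′∈)) (sym x≡Akγ)

  Ik⊆ILred : ∀ A k → Ik A k ⊆ ILred A
  Ik⊆ILred A k = filter-⊆ _ (ILred A)

  Ĩ⊆⊕ILred : ∀ {A Ã} → SpecÃ A Ã → ∀ k → k ℕ.≤ κ → Ĩ A Ã k ⊆⊕ ILred A
  Ĩ⊆⊕ILred {A}     specÃ zero    _   x∈ = atom (Ik⊆ILred A 0 x∈)
  Ĩ⊆⊕ILred {A} {Ã} specÃ (suc k) k<κ x∈
    with γ , γ∈ , x≡Ãγ ← ∈-map⁻ (Ã (suc k)) (∈-catMaybes⁻ (map (Ã (suc k)) (upTo N)) x∈)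
    with ∈-++⁻ (Ik A (suc k)) (∈-chosen (specÃ k γ k<κ (∈-upTo⁻ γ∈)) (sym x≡Ãγ))
  ... | inj₁ x∈Ik = atom (Ik⊆ILred A (suc k) x∈Ik)
  ... | inj₂ x∈glue
    with a , b , a∈ , b∈ , refl ← ∈-glue⁻ x∈glue
    = Ĩ⊆⊕ILred specÃ k (ℕP.<⇒≤ k<κ) a∈ ⊕ᵍ Ĩ⊆⊕ILred specÃ k (ℕP.<⇒≤ k<κ) b∈

  G⊆⊕ILred : ∀ {A Ã} → SpecÃ A Ã → G A Ã ⊆⊕ ILred A
  G⊆⊕ILred {A} {Ã} specÃ x∈
    with k , k∈ , x∈Ĩk ← find (∈-concatMap⁻ (Ĩ A Ã) x∈)
    = Ĩ⊆⊕ILred specÃ k (ℕP.≤-pred (∈-upTo⁻ k∈)) x∈Ĩk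

lemma2 : (κ : ℕ) (I : List Item) → ValidInstance I → ε κ ≤ + 1 / 4 →
    (ame : Item) → ame ∈ I → (∀ b → b ∈ I → eff b ≤ eff ame) →
    let open Construction κ I ame in
    IS ≢ [] →
    (aeff : Item) → aeff ∈ IS → (∀ b → b ∈ IS → eff b ≤ eff aeff) →
    (A : ℕ → ℕ → Maybe Item) → SpecA A →
    (Ã : ℕ → ℕ → Maybe Item) → SpecÃ A Ã →
    Σ ℚ λ v₁ → Σ ℚ λ v₂ → Σ ℚ λ v₃ →
      IsOPT (G A Ã ++ (aeff ∷ [])) v₁
      × IsOPT (ILred A ++ IS) v₂
      × IsOPT (IL ++ IS) v₃
      × IsOPT I v₃
      × v₁ ≤ v₂ × v₂ ≤ v₃ × v₃ ≤ (+ 2 / 1) * P0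
lemma2 κ I valid _ ame ame∈I ame-max _ aeff aeff∈IS _ A specA Ã specÃ =
  let v₁ , opt₁ = isOPT-exists _ (⊆⊕-positive L₁⊆⊕L₂ pos-L₂)
      v₂ , opt₂ = isOPT-exists _ pos-L₂
      v₃ , opt₃ = isOPT-exists I pos-I
      opt₃′     = isOPT-resp-⊆⊇ opt₃ (I⊆IL++IS κ I ame) (IL++IS⊆I κ I ame)
  in v₁ , v₂ , v₃ , opt₁ , opt₂ , opt₃′ , opt₃ ,
     isOPT-mono-⊆⊕ opt₁ opt₂ L₁⊆⊕L₂ ,
     isOPT-mono-⊆⊕ opt₂ opt₃′ (⊆⇒⊆⊕ L₂⊆IL++IS) ,
     isOPT≤2P₀ ame (All.lookup valid ame∈I) pos-I ame-max opt₃
  where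
  open Construction κ I ame
  pos-I : PositiveSizes I
  pos-I = All.map (λ valid-x → proj₁ (proj₂ valid-x)) valid
  L₂⊆IL++IS : ILred A ++ IS ⊆ IL ++ IS
  L₂⊆IL++IS = ++⁺ˡ IS (ILred⊆IL κ I ame specA)
  pos-L₂ : PositiveSizes (ILred A ++ IS)
  pos-L₂ = ⊆⊕-positive (⊆⇒⊆⊕ (IL++IS⊆I κ I ame ∘ L₂⊆IL++IS)) pos-I
  L₁⊆⊕L₂ : G A Ã ++ (aeff ∷ []) ⊆⊕ ILred A ++ IS
  L₁⊆⊕L₂ x∈ with ∈-++⁻ (G A Ã) x∈
  ... | inj₁ x∈G         = Glued-mono (xs⊆xs++ys (ILred A) IS) (G⊆⊕ILred κ I ame specÃ x∈G)
  ... | inj₂ (here refl) = atom (∈-++⁺ʳ (ILred A) aeff∈IS)
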